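{- Let $S$ be a cosimplicial complex with $N=|S|$, let $F:S\to\mathbb{Z}$ be a stack on $S$, and let $S[1],\dots,S[N]$ be an enumeration of $S$ such that for all $1\le i<j\le N$: $F(S[i])\le F(S[j])$, and $\dim(S[i])\le\dim(S[j])$ whenever $F(S[i])=F(S[j])$. Then the output of the procedure $\mathbf{Max}(S,F)$ described below (for any choice of the elements extracted from $U$) is a maximal simplex-wise $F$-sequence on $S$. Procedure $\mathbf{Max}(S,F)$: set $i:=1$, $T:=\emptyset$, $U:=\emptyset$, $W:=\langle\,\rangle$ (empty list). For each $\tau\in S$ set $\rho(\tau):=|\partial(\tau,S)|$ and, if $\rho(\tau)=1$, add $\tau$ to $U$. Then, while $i\le N$, repeat: (a) while $U\neq\emptyset$: remove an arbitrary element $\tau$ from $U$; if $\rho(\tau)=1$, let $\sigma$ be the element of $\partial(\tau,S)$ with $\sigma\notin T$; if $F(\tau)=F(\sigma)$, append the pair $(\sigma,\tau)$ to the end of $W$, set $T:=T\cup\{\sigma,\tau\}$, and for each $\mu\in\delta(\sigma,S)\cup\delta(\tau,S)$ decrease $\rho(\mu)$ by $1$ and add $\mu$ to $U$ if $\rho(\mu)=1$; (b) while $i\le N$ and $S[i]\in T$, set $i:=i+1$; (c) if $i\le N$: let $\sigma:=S[i]$, set $T:=T\cup\{\sigma\}$, append $\sigma$ to the end of $W$, and for each $\tau\in\delta(\sigma,S)$ decrease $\rho(\tau)$ by $1$ and add $\tau$ to $U$ if $\rho(\tau)=1$. Return $W$.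
   Context: A simplicial complex is a finite family of non-empty finite sets (simplexes) closed under taking non-empty subsets; $\dim(\sigma)=|\sigma|-1$. For a complex $K$ and $\sigma\in K$: $\partial(\sigma,K)=\{\mu\in K:\mu\subseteq\sigma,\dim\mu=\dim\sigma-1\}$, $\delta(\sigma,K)=\{\mu\in K:\sigma\subseteq\mu,\dim\mu=\dim\sigma+1\}$. A pair $(\sigma,\tau)$ with $\sigma\subsetneq\tau$ in $K$ is a free pair for $K$ if $\tau$ is the only face of $K$ other than $\sigma$ containing $\sigma$; then $K$ is an elementary expansion of $K\setminus\{\sigma,\tau\}$. If $\nu$ is a maximal (for inclusion) face of $K$, then $K$ is an elementary filling of $K\setminus\{\nu\}$. A finite set $S$ of simplexes is a cosimplicial complex if $\nu\in S$ whenever $\sigma\subseteq\nu\subseteq\tau$ with $\sigma,\tau\in S$. $\overline{S}$ is the set of simplexes contained in some element of $S$, and $\underline{S}=\overline{S}\setminus S$. For $\nu\in S$: $\partial(\nu,S)=\partial(\nu,\overline{S})\cap S$, $\delta(\nu,S)=\delta(\nu,\overline{S})$. A map $F:S\to\mathbb{Z}$ is a stack if $F(\sigma)\le F(\tau)$ whenever $\sigma\subseteq\tau$ in $S$. A Morse sequence from $L$ to $K$ ($L\subseteq K$ complexes) is a sequence $\langle L=K_0,\dots,K_k=K\rangle$ of simplicial complexes where each $K_i$ is an elementary expansion or an elementary filling of $K_{i-1}$; its simplex-wise form is $\langle\kappa_1,\dots,\kappa_k\rangle$ where $\kappa_i$ is the simplex $\nu$ if $K_i=K_{i-1}\cup\{\nu\}$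 is a filling (critical) and the pair $(\sigma,\tau)$ if $K_i=K_{i-1}\cup\{\sigma,\tau\}$ is an expansion with free pair $(\sigma,\tau)$ (regular). A (simplex-wise) $F$-sequence on $S$ is (the simplex-wise form of) a Morse sequence $\langle K_0,\dots,K_k\rangle$ from $\underline{S}$ to $\overline{S}$ such that $F(\sigma)=F(\tau)$ for every regular pair $(\sigma,\tau)$. It is maximal (for $F$) if for every $i\in[1,k]$ such that $K_i$ is an elementary filling of $K_{i-1}$, there is no pair $\sigma,\tau\in S\setminus K_{i-1}$ with $F(\sigma)=F(\tau)$ such that $K_{i-1}\cup\{\sigma,\tau\}$ is an elementary expansion of $K_{i-1}$ via the free pair $(\sigma,\tau)$. -}

module Defs where

open import Data.Bool using (Bool)
import Data.Bool as Bool
open import Data.Nat using (ℕ; zero; suc; _<_; _≤_)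
open import Data.Integer as ℤ using (ℤ; +_)
open import Data.Fin using (Fin)
import Data.Fin as Fin
open import Data.Fin.Subset using (Subset; _⊆_; Nonempty; ∣_∣)
open import Data.Fin.Subset.Properties using (_⊆?_)
open import Data.Vec.Properties using (≡-dec)
open import Data.List using (List; []; _∷_; _++_; [_]; filter; deduplicate; length; lookup)
open import Data.List.Membership.Propositional renaming (_∈_ to _∈ₗ_; _∉_ to _∉ₗ_)
open import Data.List.Relation.Unary.Any using (any?)
open import Data.Maybe using (Maybe; just; nothing)
open import Data.Product using (Σ; ∃; _×_; _,_)
open import Data.Sum using (_⊎_)
open import Data.Empty using (⊥)
open import Relation.Nullary using (¬_; Dec; yes; no; _×-dec_; ¬?)
open import Relation.Binary.PropositionalEquality using (_≡_; _≢_)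
open import Relation.Binary.Definitions using (DecidableEquality)
open import Relation.Binary.Construct.Closure.ReflexiveTransitive using (Star)
open import Function.Bundles using (_⇔_)

-- Simplexes on the finite vertex set Fin n are represented by subsets
-- (Subset n); a simplex must be non-empty.  dim σ = |σ| - 1 (in ℤ).

Simplex : ℕ → Set
Simplex n = Subset n

dim : ∀ {n} → Subset n → ℤ
dim σ = + ∣ σ ∣ ℤ.- + 1

_≟S_ : ∀ {n} → DecidableEquality (Subset n)
_≟S_ = ≡-dec Bool._≟_

_∈?ₗ_ : ∀ {n} (x : Subset n) (xs : List (Subset n)) → Dec (x ∈ₗ xs)
x ∈?ₗ xs = any? (λ y → x ≟S y) xs

_⊊_ : ∀ {n} → Subset n → Subset n → Set
σ ⊊ τ = σ ⊆ τ × σ ≢ τ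

-- Simplicial complexes, as predicates on Subset n (automatically finite).

Family : ℕ → Set₁
Family n = Subset n → Set

IsComplex : ∀ {n} → Family n → Set
IsComplex {n} K =
  (∀ σ → K σ → Nonempty σ) ×
  (∀ (σ τ : Subset n) → K τ → Nonempty σ → σ ⊆ τ → K σ)

_∪₁_ : ∀ {n} → Family n → Subset n → Family n
(K ∪₁ ν) μ = K μ ⊎ μ ≡ ν

_∪₂_,_ : ∀ {n} → Family n → Subset n → Subset n → Family n
(K ∪₂ σ , τ) μ = K μ ⊎ (μ ≡ σ ⊎ μ ≡ τ)

FreePair : ∀ {n} → Family n → Subset n → Subset n → Set
FreePair K σ τ =
  K σ × K τ × σ ⊊ τ × (∀ μ → K μ → σ ⊆ μ → μ ≡ σ ⊎ μ ≡ τ)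

ElemExpansion : ∀ {n} → Family n → Subset n → Subset n → Set
ElemExpansion K σ τ =
  ¬ K σ × ¬ K τ × IsComplex (K ∪₂ σ , τ) × FreePair (K ∪₂ σ , τ) σ τ

IsMaximalFace : ∀ {n} → Family n → Subset n → Set
IsMaximalFace K ν = K ν × (∀ μ → K μ → ν ⊆ μ → μ ≡ ν)

ElemFilling : ∀ {n} → Family n → Subset n → Set
ElemFilling K ν = ¬ K ν × IsComplex (K ∪₁ ν) × IsMaximalFace (K ∪₁ ν) ν

-- Cosimplicial complexes, given as a duplicate-free list (the list order
-- will serve as the enumeration S[1], …, S[N]).

IsCosimplicial : ∀ {n} → List (Subset n) → Set
IsCosimplicial {n} S =
  (∀ σ → σ ∈ₗ S → Nonempty σ) ×
  (∀ (σ ν τ : Subset n) → σ ∈ₗ S → τ ∈ₗ S → σ ⊆ ν → ν ⊆ τ → ν ∈ₗ S)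

Closure : ∀ {n} → List (Subset n) → Family n
Closure S μ = Nonempty μ × ∃ λ ν → ν ∈ₗ S × μ ⊆ ν

Under : ∀ {n} → List (Subset n) → Family n
Under S μ = Closure S μ × μ ∉ₗ S

IsStack : ∀ {n} → List (Subset n) → (Subset n → ℤ) → Set
IsStack S F = ∀ σ τ → σ ∈ₗ S → τ ∈ₗ S → σ ⊆ τ → F σ ℤ.≤ F τ

IsAdmissibleEnumeration : ∀ {n} → List (Subset n) → (Subset n → ℤ) → Set
IsAdmissibleEnumeration S F =
  ∀ (i j : Fin (length S)) → i Fin.< j →
    F (lookup S i) ℤ.≤ F (lookup S j) ×
    (F (lookup S i) ≡ F (lookup S j) → dim (lookup S i) ℤ.≤ dim (lookup S j))

data Item (n : ℕ) : Set where
  crit : Subset n → Item n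
  reg  : Subset n → Subset n → Item n

FSeqFrom : ∀ {n} → List (Subset n) → (Subset n → ℤ) → Family n → List (Item n) → Set
FSeqFrom S F K [] = ∀ μ → K μ ⇔ Closure S μ
FSeqFrom S F K (crit ν ∷ W) = ElemFilling K ν × FSeqFrom S F (K ∪₁ ν) W
FSeqFrom S F K (reg σ τ ∷ W) =
  ElemExpansion K σ τ × F σ ≡ F τ × FSeqFrom S F (K ∪₂ σ , τ) W

IsFSequence : ∀ {n} → List (Subset n) → (Subset n → ℤ) → List (Item n) → Set
IsFSequence S F W = IsComplex (Under S) × FSeqFrom S F (Under S) W

MaximalFrom : ∀ {n} → List (Subset n) → (Subset n → ℤ) → Family n → List (Item n) → Set
MaximalFrom S F K [] = Data.Unit.⊤ where import Data.Unit
MaximalFrom S F K (crit ν ∷ W) =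
  (¬ ∃ λ σ → ∃ λ τ → σ ∈ₗ S × τ ∈ₗ S × ¬ K σ × ¬ K τ × F σ ≡ F τ × ElemExpansion K σ τ)
  × MaximalFrom S F (K ∪₁ ν) W
MaximalFrom S F K (reg σ τ ∷ W) = MaximalFrom S F (K ∪₂ σ , τ) W

IsMaximalFSequence : ∀ {n} → List (Subset n) → (Subset n → ℤ) → List (Item n) → Set
IsMaximalFSequence S F W = IsFSequence S F W × MaximalFrom S F (Under S) W

-- The procedure Max(S, F), as a nondeterministic transition system.

-- ∂(τ, S) and δ(σ, S) as lists (δ computed inside S: for a cosimplicial S,
-- every coface in S̄ of an element of S lies in S).
∂L : ∀ {n} → List (Subset n) → Subset n → List (Subset n)
∂L S τ = filter (λ μ → (μ ⊆? τ) ×-dec (dim μ ℤ.≟ dim τ ℤ.- + 1)) S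

δL : ∀ {n} → List (Subset n) → Subset n → List (Subset n)
δL S σ = filter (λ μ → (σ ⊆? μ) ×-dec (dim μ ℤ.≟ dim σ ℤ.+ + 1)) S

-- S[i], 1-based
entry : ∀ {A : Set} → List A → ℕ → Maybe A
entry xs zero = nothing
entry [] (suc i) = nothing
entry (x ∷ xs) (suc zero) = just x
entry (x ∷ xs) (suc (suc i)) = entry xs (suc i)

insert : ∀ {n} → Subset n → List (Subset n) → List (Subset n)
insert x xs with x ∈?ₗ xs
... | yes _ = xs
... | no _ = xs ++ [ x ]

remove : ∀ {n} → Subset n → List (Subset n) → List (Subset n)
remove x xs = filter (λ y → ¬? (y ≟S x)) xs

update : ∀ {n} → (Subset n → ℤ) → Subset n → ℤ → (Subset n → ℤ)
update ρ x v y with y ≟S x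
... | yes _ = v
... | no _ = ρ y

decrAll : ∀ {n} → List (Subset n) → (Subset n → ℤ) → List (Subset n)
        → (Subset n → ℤ) × List (Subset n)
decrAll [] ρ U = ρ , U
decrAll (μ ∷ ms) ρ U with ρ μ ℤ.- + 1 ℤ.≟ + 1
... | yes _ = decrAll ms (update ρ μ (ρ μ ℤ.- + 1)) (insert μ U)
... | no _ = decrAll ms (update ρ μ (ρ μ ℤ.- + 1)) U

-- control points: outer-loop test, steps (a), (b), (c), and termination
data Phase : Set where
  loop pa pb pc done : Phase

record State (n : ℕ) : Set where
  constructor st
  field
    phase : Phase
    i     : ℕ
    T     : List (Subset n)
    U     : List (Subset n)
    ρ     : Subset n → ℤ
    W     : List (Item n)

module _ {n : ℕ} (S : List (Subset n)) (F : Subset n → ℤ) where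

  ρ₀ : Subset n → ℤ
  ρ₀ τ = + length (∂L S τ)

  initState : State n
  initState = st loop 1 [] (filter (λ τ → ρ₀ τ ℤ.≟ + 1) S) ρ₀ []

  data Step : State n → State n → Set where
    loop-go   : ∀ {i T U ρ W} → i ≤ length S →
                Step (st loop i T U ρ W) (st pa i T U ρ W)
    loop-stop : ∀ {i T U ρ W} → ¬ i ≤ length S →
                Step (st loop i T U ρ W) (st done i T U ρ W)
    a-exit    : ∀ {i T ρ W} → Step (st pa i T [] ρ W) (st pb i T [] ρ W)
    a-skip    : ∀ {i T U ρ W τ} → τ ∈ₗ U → ρ τ ≢ + 1 →
                Step (st pa i T U ρ W) (st pa i T (remove τ U) ρ W)
    a-noexp   : ∀ {i T U ρ W τ σ} → τ ∈ₗ U → ρ τ ≡ + 1 →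
                σ ∈ₗ ∂L S τ → σ ∉ₗ T → F τ ≢ F σ →
                Step (st pa i T U ρ W) (st pa i T (remove τ U) ρ W)
    a-exp     : ∀ {i T U ρ W τ σ} → τ ∈ₗ U → ρ τ ≡ + 1 →
                σ ∈ₗ ∂L S τ → σ ∉ₗ T → F τ ≡ F σ →
                let r = decrAll (deduplicate _≟S_ (δL S σ ++ δL S τ)) ρ (remove τ U)
                in Step (st pa i T U ρ W)
                        (st pa i (insert τ (insert σ T)) (Data.Product.proj₂ r)
                            (Data.Product.proj₁ r) (W ++ [ reg σ τ ]))
    b-next    : ∀ {i T U ρ W σ} → i ≤ length S → entry S i ≡ just σ → σ ∈ₗ T →
                Step (st pb i T U ρ W) (st pb (suc i) T U ρ W)
    b-exit    : ∀ {i T U ρ W} →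
                ¬ (∃ λ σ → i ≤ length S × entry S i ≡ just σ × σ ∈ₗ T) →
                Step (st pb i T U ρ W) (st pc i T U ρ W)
    c-crit    : ∀ {i T U ρ W σ} → i ≤ length S → entry S i ≡ just σ →
                let r = decrAll (δL S σ) ρ U
                in Step (st pc i T U ρ W)
                        (st loop i (insert σ T) (Data.Product.proj₂ r)
                            (Data.Product.proj₁ r) (W ++ [ crit σ ]))
    c-skip    : ∀ {i T U ρ W} → ¬ i ≤ length S →
                Step (st pc i T U ρ W) (st loop i T U ρ W)

IsMaxOutput : ∀ {n} → List (Subset n) → (Subset n → ℤ) → List (Item n) → Set
IsMaxOutput {n} S F W =
  ∃ λ (s : State n) → Star (Step S F) (initState S F) s ×
    State.phase s ≡ done × State.W s ≡ W

-- Max(S, F) maintains an invariant on its state: T is a subset of S closed under faces within S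
-- and containing S[1], …, S[i-1]; ρ μ is the number of facets of μ in S outside T; U holds every
-- μ ∉ T with exactly one such facet, of the same F-value as μ; and W is a maximal F-sequence from
-- S̲ to S̲ ∪ T.  A pair (σ, τ) taken from U is an elementary expansion of S̲ ∪ T because σ is the
-- only facet of τ outside T, so every other proper face of τ lies in T.  A critical σ = S[i] is
-- added only when U is empty: its proper faces precede it in the enumeration (an equal F-value
-- forces a smaller dimension), so it is an elementary filling, and no F-expansion is available,
-- since its upper simplex would lie in U.  Once i > N, T = S and S̲ ∪ T = S̄.

module Submission where

open import Defs
open import Data.Nat using (ℕ; zero; suc; _<_; _≤_; z≤n; s≤s)
import Data.Nat.Properties as ℕP
open import Data.Integer as ℤ using (ℤ; +_)
import Data.Integer.Properties as ℤP
open import Data.Fin using (Fin; toℕ)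
import Data.Fin.Properties as FinP
open import Data.Fin.Subset
  using (Subset; Nonempty; ∣_∣; _-_; ⁅_⁆; _∈_; _∉_; _⊆_; _⊂_; inside; outside)
open import Data.Fin.Subset.Properties
  using (p─⊥≡p; ⊆-antisym; p─q⊆p; x∈p∧x≢y⇒x∈p-y; p⊂q⇒∣p∣<∣q∣; _∈?_; _⊆?_)
open import Data.Vec using (_∷_)
open import Data.Vec.Base using (here; there)
open import Data.Product using (∃; _×_; _,_; proj₁; proj₂)
open import Data.Sum using (_⊎_; inj₁; inj₂)
import Data.Sum
open import Data.Empty using (⊥; ⊥-elim)
open import Data.Unit using (⊤)
open import Data.Maybe using (just)
open import Data.Maybe.Properties using (just-injective)
open import Data.List using (List; []; _∷_; _++_; [_]; filter; length; lookup; deduplicate)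
import Data.List.Properties as LP
open import Data.List.Membership.Propositional using () renaming (_∈_ to _∈ₗ_; _∉_ to _∉ₗ_)
open import Data.List.Membership.Propositional.Properties
  using (∈-filter⁺; ∈-filter⁻; ∈-++⁺ˡ; ∈-++⁺ʳ; ∈-++⁻; ∈-lookup; ∈-deduplicate⁺; ∈-deduplicate⁻)
open import Data.List.Relation.Unary.Any using (here; there; index)
open import Data.List.Relation.Unary.Any.Properties using (lookup-index)
open import Data.List.Relation.Unary.All using (_∷_)
import Data.List.Relation.Unary.All as All
open import Data.List.Relation.Unary.AllPairs using (_∷_)
open import Data.List.Relation.Unary.Unique.Propositional using (Unique)
import Data.List.Relation.Unary.Unique.Propositional.Properties as Unique
open import Data.List.Relation.Unary.Unique.DecPropositional.Properties using (deduplicate-!)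
open import Function using (_∘_)
open import Function.Bundles using (_⇔_; mk⇔; Equivalence)
open import Relation.Nullary using (¬_; Dec; yes; no; _×-dec_; ¬?; contradiction)
open import Relation.Nullary.Decidable using (decidable-stable)
open import Relation.Unary using (_≐_)
open import Relation.Binary.Definitions using (tri<; tri≈; tri>)
open import Relation.Binary.Construct.Closure.ReflexiveTransitive using (Star; ε; _◅_)
open import Relation.Binary.PropositionalEquality
  using (_≡_; _≢_; refl; sym; trans; cong; subst; module ≡-Reasoning)
open ≡-Reasoning

x∉p-x : ∀ {n} {p : Subset n} {x : Fin n} → x ∉ p - x
x∉p-x {p = _ ∷ _} {Fin.suc x} (there x∈p-x) = x∉p-x x∈p-x

x∈p⇒∣p-x∣+1≡∣p∣ : ∀ {n} {p : Subset n} {x : Fin n} → x ∈ p → suc ∣ p - x ∣ ≡ ∣ p ∣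
x∈p⇒∣p-x∣+1≡∣p∣ {p = inside ∷ p}  here        = cong (λ q → suc ∣ q ∣) (p─⊥≡p p)
x∈p⇒∣p-x∣+1≡∣p∣ {p = inside ∷ _}  (there x∈p) = cong suc (x∈p⇒∣p-x∣+1≡∣p∣ x∈p)
x∈p⇒∣p-x∣+1≡∣p∣ {p = outside ∷ _} (there x∈p) = x∈p⇒∣p-x∣+1≡∣p∣ x∈p

infix 4 _⋖_

_⋖_ : ∀ {n} → Subset n → Subset n → Set
σ ⋖ τ = σ ⊆ τ × suc ∣ σ ∣ ≡ ∣ τ ∣

module _ {n : ℕ} where

  ⊊⇒⊂ : {p q : Subset n} → p ⊊ q → p ⊂ q
  ⊊⇒⊂ {p} {q} (p⊆q , p≢q) with FinP.any? (λ x → (x ∈? q) ×-dec ¬? (x ∈? p))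
  ... | yes witness = p⊆q , witness
  ... | no ∄witness = contradiction (⊆-antisym p⊆q q⊆p) p≢q
    where
    q⊆p : q ⊆ p
    q⊆p {x} x∈q = decidable-stable (x ∈? p) (λ x∉p → ∄witness (x , x∈q , x∉p))

  ⋖⇒⊊ : {σ τ : Subset n} → σ ⋖ τ → σ ⊊ τ
  ⋖⇒⊊ (σ⊆τ , size) = σ⊆τ , λ σ≡τ → ℕP.1+n≢n (trans size (cong ∣_∣ (sym σ≡τ)))

  ⊆-⊊-trans : {p q r : Subset n} → p ⊆ q → q ⊊ r → p ⊊ r
  ⊆-⊊-trans p⊆q (q⊆r , q≢r) = q⊆r ∘ p⊆q , λ { refl → q≢r (⊆-antisym q⊆r p⊆q) }

  no-⋖-triangle : {σ τ μ : Subset n} → σ ⋖ τ → τ ⋖ μ → ¬ σ ⋖ μ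
  no-⋖-triangle (_ , ∣σ∣+1≡∣τ∣) (_ , ∣τ∣+1≡∣μ∣) (_ , ∣σ∣+1≡∣μ∣) =
    ℕP.1+n≢n (trans ∣τ∣+1≡∣μ∣ (trans (sym ∣σ∣+1≡∣μ∣) ∣σ∣+1≡∣τ∣))

  x∉p∧p⊆q⇒p⊆q-x : {p q : Subset n} {x : Fin n} → x ∉ p → p ⊆ q → p ⊆ q - x
  x∉p∧p⊆q⇒p⊆q-x x∉p p⊆q y∈p = x∈p∧x≢y⇒x∈p-y (p⊆q y∈p) (λ { refl → x∉p y∈p })

  p-x⋖p : {p : Subset n} {x : Fin n} → x ∈ p → p - x ⋖ p
  p-x⋖p {p} {x} x∈p = p─q⊆p p ⁅ x ⁆ , x∈p⇒∣p-x∣+1≡∣p∣ x∈p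

  -- Delete from τ a vertex outside ν; should that give σ, delete instead a vertex of σ outside ν.
  facet-avoiding : {ν σ τ : Subset n} → ν ⊊ τ → ν ≢ σ → ∃ λ φ → ν ⊆ φ × φ ⋖ τ × φ ≢ σ
  facet-avoiding {ν} {σ} {τ} ν⊊τ ν≢σ with ⊊⇒⊂ ν⊊τ
  ... | ν⊆τ , x , x∈τ , x∉ν with (τ - x) ≟S σ
  ... | no τ-x≢σ = τ - x , x∉p∧p⊆q⇒p⊆q-x x∉ν ν⊆τ , p-x⋖p x∈τ , τ-x≢σ
  ... | yes refl with ⊊⇒⊂ (x∉p∧p⊆q⇒p⊆q-x x∉ν ν⊆τ , ν≢σ)
  ... | _ , z , z∈σ , z∉ν =
    τ - z , x∉p∧p⊆q⇒p⊆q-x z∉ν ν⊆τ , p-x⋖p (p─q⊆p τ ⁅ x ⁆ z∈σ) ,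
    λ τ-z≡σ → x∉p-x (subst (z ∈_) (sym τ-z≡σ) z∈σ)

  FreePair⇒⋖ : {K : Family n} {σ τ : Subset n} → IsComplex K → FreePair K σ τ → σ ⋖ τ
  FreePair⇒⋖ {K} {σ} {τ} (nonempty , closed) (σ∈K , τ∈K , σ⊊τ , free) with ⊊⇒⊂ σ⊊τ
  ... | σ⊆τ , x , x∈τ , x∉σ with free (τ - x) τ-x∈K σ⊆τ-x
    where
    σ⊆τ-x = x∉p∧p⊆q⇒p⊆q-x x∉σ σ⊆τ
    τ-x≠∅ = proj₁ (nonempty σ σ∈K) , σ⊆τ-x (proj₂ (nonempty σ σ∈K))
    τ-x∈K = closed (τ - x) τ τ∈K τ-x≠∅ (p─q⊆p τ ⁅ x ⁆)
  ... | inj₁ τ-x≡σ = σ⊆τ , subst (λ φ → suc ∣ φ ∣ ≡ ∣ τ ∣) τ-x≡σ (x∈p⇒∣p-x∣+1≡∣p∣ x∈τ)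
  ... | inj₂ τ-x≡τ = contradiction (subst (x ∈_) (sym τ-x≡τ) x∈τ) x∉p-x

-- dim σ unfolds to + ∣ σ ∣ ℤ.- + 1, so dimension constraints are constraints on sizes.
private
  facet-size : ∀ a b → + a ℤ.- + 1 ≡ (+ b ℤ.- + 1) ℤ.- + 1 → suc a ≡ b
  facet-size zero    (suc zero)    _ = refl
  facet-size (suc a) (suc (suc b)) e = cong (λ k → suc (suc k)) (ℤP.+-injective e)
  facet-size zero    zero          ()
  facet-size zero    (suc (suc b)) ()
  facet-size (suc a) zero          ()
  facet-size (suc a) (suc zero)    ()

  coface-size : ∀ a b → + a ℤ.- + 1 ≡ (+ b ℤ.- + 1) ℤ.+ + 1 → a ≡ suc b
  coface-size (suc a) zero    e = cong suc (ℤP.+-injective e)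
  coface-size (suc a) (suc b) e = cong suc (trans (ℤP.+-injective e) (ℕP.+-comm b 1))
  coface-size zero    zero    ()
  coface-size zero    (suc b) ()

  coface-dim : ∀ b → + suc b ℤ.- + 1 ≡ (+ b ℤ.- + 1) ℤ.+ + 1
  coface-dim zero    = refl
  coface-dim (suc b) = cong +_ (ℕP.+-comm 1 b)

  size-mono : ∀ a b → + a ℤ.- + 1 ℤ.≤ + b ℤ.- + 1 → a ≤ b
  size-mono zero    b       _  = z≤n
  size-mono (suc a) (suc b) le = s≤s (ℤP.drop‿+≤+ le)
  size-mono (suc a) zero    ()

dim-mono⁻¹ : ∀ {n} (σ τ : Subset n) → dim σ ℤ.≤ dim τ → ∣ σ ∣ ≤ ∣ τ ∣
dim-mono⁻¹ σ τ = size-mono ∣ σ ∣ ∣ τ ∣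

module _ {n : ℕ} (S : List (Subset n)) where

  ∈-∂L⁻ : ∀ {μ τ} → μ ∈ₗ ∂L S τ → μ ∈ₗ S × μ ⋖ τ
  ∈-∂L⁻ {μ} {τ} μ∈∂τ with ∈-filter⁻ (λ ν → (ν ⊆? τ) ×-dec (dim ν ℤ.≟ dim τ ℤ.- + 1)) μ∈∂τ
  ... | μ∈S , μ⊆τ , dims = μ∈S , μ⊆τ , facet-size ∣ μ ∣ ∣ τ ∣ dims

  ∈-∂L⁺ : ∀ {μ τ} → μ ∈ₗ S → μ ⋖ τ → μ ∈ₗ ∂L S τ
  ∈-∂L⁺ {μ} {τ} μ∈S (μ⊆τ , size) =
    ∈-filter⁺ (λ ν → (ν ⊆? τ) ×-dec (dim ν ℤ.≟ dim τ ℤ.- + 1)) μ∈S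
      (μ⊆τ , cong (λ k → (+ k ℤ.- + 1) ℤ.- + 1) size)

  ∈-δL⁻ : ∀ {μ σ} → μ ∈ₗ δL S σ → μ ∈ₗ S × σ ⋖ μ
  ∈-δL⁻ {μ} {σ} μ∈δσ with ∈-filter⁻ (λ ν → (σ ⊆? ν) ×-dec (dim ν ℤ.≟ dim σ ℤ.+ + 1)) μ∈δσ
  ... | μ∈S , σ⊆μ , dims = μ∈S , σ⊆μ , sym (coface-size ∣ μ ∣ ∣ σ ∣ dims)

  ∈-δL⁺ : ∀ {μ σ} → μ ∈ₗ S → σ ⋖ μ → μ ∈ₗ δL S σ
  ∈-δL⁺ {μ} {σ} μ∈S (σ⊆μ , size) =
    ∈-filter⁺ (λ ν → (σ ⊆? ν) ×-dec (dim ν ℤ.≟ dim σ ℤ.+ + 1)) μ∈S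
      (σ⊆μ , subst (λ k → + k ℤ.- + 1 ≡ dim σ ℤ.+ + 1) size (coface-dim ∣ σ ∣))

module _ {A : Set} where

  head∉tail : ∀ {x} {xs : List A} → Unique (x ∷ xs) → x ∉ₗ xs
  head∉tail (x∉xs ∷ _) x∈xs = All.lookup x∉xs x∈xs refl

  length≡1⇒≡ : ∀ {xs : List A} {x y} → length xs ≡ 1 → x ∈ₗ xs → y ∈ₗ xs → x ≡ y
  length≡1⇒≡ {_ ∷ []} _ (here refl) (here refl) = refl

  unique-singleton : ∀ {xs : List A} {x} → Unique xs → x ∈ₗ xs → (∀ {y} → y ∈ₗ xs → y ≡ x) →
                     length xs ≡ 1
  unique-singleton {_ ∷ []} _ _ _ = refl
  unique-singleton {y ∷ z ∷ _} ((y≢z ∷ _) ∷ _) _ ≡x =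
    contradiction (trans (≡x (here refl)) (sym (≡x (there (here refl))))) y≢z

  lookup⇒entry : ∀ (xs : List A) k → entry xs (suc (toℕ k)) ≡ just (lookup xs k)
  lookup⇒entry (x ∷ xs) Fin.zero    = refl
  lookup⇒entry (x ∷ xs) (Fin.suc k) = lookup⇒entry xs k

  entry-∈ : ∀ (xs : List A) i {x} → entry xs i ≡ just x → x ∈ₗ xs
  entry-∈ (x ∷ xs) (suc zero)    refl = here refl
  entry-∈ (x ∷ xs) (suc (suc i)) e    = there (entry-∈ xs (suc i) e)

  entry⇒lookup : ∀ (xs : List A) i {x} → entry xs i ≡ just x →
                 ∃ λ (k : Fin (length xs)) → suc (toℕ k) ≡ i × lookup xs k ≡ x
  entry⇒lookup (x ∷ xs) (suc zero)    refl = Fin.zero , refl , refl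
  entry⇒lookup (x ∷ xs) (suc (suc i)) e with entry⇒lookup xs (suc i) e
  ... | k , refl , xₖ≡ = Fin.suc k , refl , xₖ≡

module _ {n : ℕ} where

  ∈-insert⁻ : ∀ {x y : Subset n} {T} → y ∈ₗ insert x T → y ∈ₗ T ⊎ y ≡ x
  ∈-insert⁻ {x} {T = T} y∈ with x ∈?ₗ T
  ... | yes _ = inj₁ y∈
  ... | no _ with ∈-++⁻ T y∈
  ...   | inj₁ y∈T         = inj₁ y∈T
  ...   | inj₂ (here refl) = inj₂ refl

  ∈-insert⁺ : ∀ {x y : Subset n} {T} → y ∈ₗ T → y ∈ₗ insert x T
  ∈-insert⁺ {x} {T = T} y∈T with x ∈?ₗ T
  ... | yes _ = y∈T
  ... | no _  = ∈-++⁺ˡ y∈T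

  x∈insert : ∀ {x : Subset n} {T} → x ∈ₗ insert x T
  x∈insert {x} {T} with x ∈?ₗ T
  ... | yes x∈T = x∈T
  ... | no _    = ∈-++⁺ʳ T (here refl)

  ∉-insert : ∀ {x y : Subset n} {T} → y ∉ₗ T → y ≢ x → y ∉ₗ insert x T
  ∉-insert {T = T} y∉T y≢x y∈T⁺ with ∈-insert⁻ {T = T} y∈T⁺
  ... | inj₁ y∈T = y∉T y∈T
  ... | inj₂ y≡x = y≢x y≡x

  ∈-remove⁻ : ∀ {x y : Subset n} {U} → y ∈ₗ remove x U → y ∈ₗ U
  ∈-remove⁻ {x} y∈ = proj₁ (∈-filter⁻ (λ z → ¬? (z ≟S x)) y∈)

  ∈-remove⁺ : ∀ {x y : Subset n} {U} → y ∈ₗ U → y ≢ x → y ∈ₗ remove x U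
  ∈-remove⁺ {x} = ∈-filter⁺ (λ z → ¬? (z ≟S x))

  update-≡ : ∀ (ρ : Subset n → ℤ) x v → update ρ x v x ≡ v
  update-≡ ρ x v with x ≟S x
  ... | yes _   = refl
  ... | no x≢x = contradiction refl x≢x

  update-≢ : ∀ (ρ : Subset n → ℤ) x v {y} → y ≢ x → update ρ x v y ≡ ρ y
  update-≢ ρ x v {y} y≢x with y ≟S x
  ... | yes y≡x = contradiction y≡x y≢x
  ... | no _    = refl

  infixl 6 _∖_

  _∖_ : List (Subset n) → List (Subset n) → List (Subset n)
  xs ∖ T = filter (λ y → ¬? (y ∈?ₗ T)) xs

  xs∖[]≡xs : ∀ xs → xs ∖ [] ≡ xs
  xs∖[]≡xs xs = LP.filter-all (λ y → ¬? (y ∈?ₗ [])) (All.universal (λ _ ()) xs)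

  ∖-∷-∈ : ∀ {y} {ys T} → y ∈ₗ T → (y ∷ ys) ∖ T ≡ ys ∖ T
  ∖-∷-∈ y∈T = LP.filter-reject (λ z → ¬? (z ∈?ₗ _)) (λ y∉T → y∉T y∈T)

  ∖-∷-∉ : ∀ {y} {ys T} → y ∉ₗ T → (y ∷ ys) ∖ T ≡ y ∷ ys ∖ T
  ∖-∷-∉ = LP.filter-accept (λ z → ¬? (z ∈?ₗ _))

  ∖-insert-∉ : ∀ {x} T xs → x ∉ₗ xs → xs ∖ insert x T ≡ xs ∖ T
  ∖-insert-∉ T [] _ = refl
  ∖-insert-∉ {x} T (y ∷ ys) x∉y∷ys = by-cases (y ∈?ₗ T)
    where
    by-cases : Dec (y ∈ₗ T) → (y ∷ ys) ∖ insert x T ≡ (y ∷ ys) ∖ T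
    by-cases (yes y∈T) = begin
      (y ∷ ys) ∖ insert x T ≡⟨ ∖-∷-∈ (∈-insert⁺ y∈T) ⟩
      ys ∖ insert x T       ≡⟨ ∖-insert-∉ T ys (x∉y∷ys ∘ there) ⟩
      ys ∖ T                ≡⟨ ∖-∷-∈ y∈T ⟨
      (y ∷ ys) ∖ T          ∎
    by-cases (no y∉T) = begin
      (y ∷ ys) ∖ insert x T ≡⟨ ∖-∷-∉ (∉-insert y∉T (λ { refl → x∉y∷ys (here refl) })) ⟩
      y ∷ ys ∖ insert x T   ≡⟨ cong (y ∷_) (∖-insert-∉ T ys (x∉y∷ys ∘ there)) ⟩
      y ∷ ys ∖ T            ≡⟨ ∖-∷-∉ y∉T ⟨
      (y ∷ ys) ∖ T          ∎

  length-∖-insert-∈ : ∀ {x} T xs → Unique xs → x ∈ₗ xs → x ∉ₗ T →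
                      suc (length (xs ∖ insert x T)) ≡ length (xs ∖ T)
  length-∖-insert-∈ {x} T (x ∷ ys) x∷ys! (here refl) x∉T = begin
    suc (length ((x ∷ ys) ∖ insert x T))
      ≡⟨ cong (suc ∘ length) (∖-∷-∈ {ys = ys} {T = insert x T} (x∈insert {T = T})) ⟩
    suc (length (ys ∖ insert x T))
      ≡⟨ cong (suc ∘ length) (∖-insert-∉ T ys (head∉tail x∷ys!)) ⟩
    suc (length (ys ∖ T))
      ≡⟨ cong length (∖-∷-∉ x∉T) ⟨
    length ((x ∷ ys) ∖ T)
      ∎
  length-∖-insert-∈ {x} T (y ∷ ys) y∷ys!@(_ ∷ ys!) (there x∈ys) x∉T = by-cases (y ∈?ₗ T)
    where
    by-cases : Dec (y ∈ₗ T) → suc (length ((y ∷ ys) ∖ insert x T)) ≡ length ((y ∷ ys) ∖ T)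
    by-cases (yes y∈T) = begin
      suc (length ((y ∷ ys) ∖ insert x T))
        ≡⟨ cong (suc ∘ length) (∖-∷-∈ {ys = ys} {T = insert x T} (∈-insert⁺ y∈T)) ⟩
      suc (length (ys ∖ insert x T))
        ≡⟨ length-∖-insert-∈ T ys ys! x∈ys x∉T ⟩
      length (ys ∖ T)
        ≡⟨ cong length (∖-∷-∈ y∈T) ⟨
      length ((y ∷ ys) ∖ T)
        ∎
    by-cases (no y∉T) = begin
      suc (length ((y ∷ ys) ∖ insert x T))
        ≡⟨ cong (suc ∘ length) (∖-∷-∉ (∉-insert y∉T λ { refl → head∉tail y∷ys! x∈ys })) ⟩
      suc (suc (length (ys ∖ insert x T)))
        ≡⟨ cong suc (length-∖-insert-∈ T ys ys! x∈ys x∉T) ⟩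
      suc (length (ys ∖ T))
        ≡⟨ cong length (∖-∷-∉ y∉T) ⟨
      length ((y ∷ ys) ∖ T)
        ∎

  decrAll-ρ-∉ : ∀ L (ρ : Subset n → ℤ) U {μ} → μ ∉ₗ L → proj₁ (decrAll L ρ U) μ ≡ ρ μ
  decrAll-ρ-∉ [] ρ U μ∉L = refl
  decrAll-ρ-∉ (ν ∷ L) ρ U μ∉ν∷L with ρ ν ℤ.- + 1 ℤ.≟ + 1
  ... | yes _ = trans (decrAll-ρ-∉ L _ _ (μ∉ν∷L ∘ there)) (update-≢ ρ ν _ (μ∉ν∷L ∘ here))
  ... | no _  = trans (decrAll-ρ-∉ L _ _ (μ∉ν∷L ∘ there)) (update-≢ ρ ν _ (μ∉ν∷L ∘ here))

  decrAll-ρ-∈ : ∀ L (ρ : Subset n → ℤ) U {μ} → Unique L → μ ∈ₗ L →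
                proj₁ (decrAll L ρ U) μ ≡ ρ μ ℤ.- + 1
  decrAll-ρ-∈ (ν ∷ L) ρ U ν∷L! (here refl) with ρ ν ℤ.- + 1 ℤ.≟ + 1
  ... | yes _ = trans (decrAll-ρ-∉ L _ _ (head∉tail ν∷L!)) (update-≡ ρ ν _)
  ... | no _  = trans (decrAll-ρ-∉ L _ _ (head∉tail ν∷L!)) (update-≡ ρ ν _)
  decrAll-ρ-∈ (ν ∷ L) ρ U {μ} ν∷L!@(_ ∷ L!) (there μ∈L) with ρ ν ℤ.- + 1 ℤ.≟ + 1
  ... | yes _ = trans (decrAll-ρ-∈ L _ _ L! μ∈L) (cong (ℤ._- + 1) (update-≢ ρ ν _ μ≢ν))
    where μ≢ν : μ ≢ ν
          μ≢ν refl = head∉tail ν∷L! μ∈L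
  ... | no _  = trans (decrAll-ρ-∈ L _ _ L! μ∈L) (cong (ℤ._- + 1) (update-≢ ρ ν _ μ≢ν))
    where μ≢ν : μ ≢ ν
          μ≢ν refl = head∉tail ν∷L! μ∈L

  decrAll-U⁺ : ∀ L (ρ : Subset n → ℤ) U {μ} → μ ∈ₗ U → μ ∈ₗ proj₂ (decrAll L ρ U)
  decrAll-U⁺ [] ρ U μ∈U = μ∈U
  decrAll-U⁺ (ν ∷ L) ρ U μ∈U with ρ ν ℤ.- + 1 ℤ.≟ + 1
  ... | yes _ = decrAll-U⁺ L _ _ (∈-insert⁺ μ∈U)
  ... | no _  = decrAll-U⁺ L _ _ μ∈U

  decrAll-U⁻ : ∀ L (ρ : Subset n → ℤ) U {μ} → μ ∈ₗ proj₂ (decrAll L ρ U) → μ ∈ₗ U ⊎ μ ∈ₗ L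
  decrAll-U⁻ [] ρ U μ∈U = inj₁ μ∈U
  decrAll-U⁻ (ν ∷ L) ρ U μ∈ with ρ ν ℤ.- + 1 ℤ.≟ + 1
  ... | no _ = Data.Sum.map₂ there (decrAll-U⁻ L _ _ μ∈)
  ... | yes _ with decrAll-U⁻ L _ _ μ∈
  ...   | inj₂ μ∈L = inj₂ (there μ∈L)
  ...   | inj₁ μ∈U⁺ = Data.Sum.map₂ here (∈-insert⁻ {T = U} μ∈U⁺)

  decrAll-U-new : ∀ L (ρ : Subset n → ℤ) U {μ} → Unique L → μ ∈ₗ L →
                  proj₁ (decrAll L ρ U) μ ≡ + 1 → μ ∈ₗ proj₂ (decrAll L ρ U)
  decrAll-U-new (ν ∷ L) ρ U ν∷L! (here refl) ρ′ν≡1 with ρ ν ℤ.- + 1 ℤ.≟ + 1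
  ... | yes _     = decrAll-U⁺ L _ _ (x∈insert {T = U})
  ... | no ρν-1≢1 = contradiction (begin
    ρ ν ℤ.- + 1                                      ≡⟨ update-≡ ρ ν _ ⟨
    update ρ ν (ρ ν ℤ.- + 1) ν                       ≡⟨ decrAll-ρ-∉ L _ U (head∉tail ν∷L!) ⟨
    proj₁ (decrAll L (update ρ ν (ρ ν ℤ.- + 1)) U) ν ≡⟨ ρ′ν≡1 ⟩
    + 1                                              ∎) ρν-1≢1
  decrAll-U-new (ν ∷ L) ρ U (_ ∷ L!) (there μ∈L) ρ′μ≡1 with ρ ν ℤ.- + 1 ℤ.≟ + 1
  ... | yes _ = decrAll-U-new L _ _ L! μ∈L ρ′μ≡1
  ... | no _  = decrAll-U-new L _ _ L! μ∈L ρ′μ≡1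

module _ {n : ℕ} where

  ∪₁-cong : ∀ {K K′ : Family n} ν → K ≐ K′ → (K ∪₁ ν) ≐ (K′ ∪₁ ν)
  ∪₁-cong ν (K⊆K′ , K′⊆K) = Data.Sum.map₁ K⊆K′ , Data.Sum.map₁ K′⊆K

  ∪₂-cong : ∀ {K K′ : Family n} σ τ → K ≐ K′ → (K ∪₂ σ , τ) ≐ (K′ ∪₂ σ , τ)
  ∪₂-cong σ τ (K⊆K′ , K′⊆K) = Data.Sum.map₁ K⊆K′ , Data.Sum.map₁ K′⊆K

  IsComplex-resp-≐ : ∀ {K K′ : Family n} → K ≐ K′ → IsComplex K → IsComplex K′
  IsComplex-resp-≐ (K⊆K′ , K′⊆K) (nonempty , closed) =
    (λ σ σ∈K′ → nonempty σ (K′⊆K σ∈K′)) ,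
    (λ σ τ τ∈K′ σ≠∅ σ⊆τ → K⊆K′ (closed σ τ (K′⊆K τ∈K′) σ≠∅ σ⊆τ))

  FreePair-resp-≐ : ∀ {K K′ : Family n} {σ τ} → K ≐ K′ → FreePair K σ τ → FreePair K′ σ τ
  FreePair-resp-≐ (K⊆K′ , K′⊆K) (σ∈K , τ∈K , σ⊊τ , free) =
    K⊆K′ σ∈K , K⊆K′ τ∈K , σ⊊τ , λ μ μ∈K′ → free μ (K′⊆K μ∈K′)

  ElemExpansion-resp-≐ : ∀ {K K′ : Family n} {σ τ} → K ≐ K′ →
                         ElemExpansion K σ τ → ElemExpansion K′ σ τ
  ElemExpansion-resp-≐ {σ = σ} {τ} K≐K′@(_ , K′⊆K) (σ∉K , τ∉K , complex , free) =
    σ∉K ∘ K′⊆K , τ∉K ∘ K′⊆K , IsComplex-resp-≐ (∪₂-cong σ τ K≐K′) complex ,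
    FreePair-resp-≐ (∪₂-cong σ τ K≐K′) free

  ElemFilling-resp-≐ : ∀ {K K′ : Family n} {ν} → K ≐ K′ → ElemFilling K ν → ElemFilling K′ ν
  ElemFilling-resp-≐ {ν = ν} K≐K′@(_ , K′⊆K) (ν∉K , complex , ν∈Kν , maximal) =
    ν∉K ∘ K′⊆K , IsComplex-resp-≐ Kν≐K′ν complex ,
    proj₁ Kν≐K′ν ν∈Kν , λ μ μ∈K′ν → maximal μ (proj₂ Kν≐K′ν μ∈K′ν)
    where Kν≐K′ν = ∪₁-cong ν K≐K′

  module _ (S : List (Subset n)) (F : Subset n → ℤ) where

    FSeqFrom-resp-≐ : ∀ {K K′} W → K ≐ K′ → FSeqFrom S F K W → FSeqFrom S F K′ W
    FSeqFrom-resp-≐ [] (K⊆K′ , K′⊆K) K≐S̄ μ =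
      mk⇔ (Equivalence.to (K≐S̄ μ) ∘ K′⊆K) (K⊆K′ ∘ Equivalence.from (K≐S̄ μ))
    FSeqFrom-resp-≐ (crit ν ∷ W) K≐K′ (filling , rest) =
      ElemFilling-resp-≐ K≐K′ filling , FSeqFrom-resp-≐ W (∪₁-cong ν K≐K′) rest
    FSeqFrom-resp-≐ (reg σ τ ∷ W) K≐K′ (expansion , Fσ≡Fτ , rest) =
      ElemExpansion-resp-≐ K≐K′ expansion , Fσ≡Fτ , FSeqFrom-resp-≐ W (∪₂-cong σ τ K≐K′) rest

    MaximalFrom-resp-≐ : ∀ {K K′} W → K ≐ K′ → MaximalFrom S F K W → MaximalFrom S F K′ W
    MaximalFrom-resp-≐ [] _ _ = _
    MaximalFrom-resp-≐ (crit ν ∷ W) K≐K′@(K⊆K′ , K′⊆K) (no-expansion , rest) =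
      (λ (σ , τ , σ∈S , τ∈S , σ∉K′ , τ∉K′ , Fσ≡Fτ , expansion) →
         no-expansion (σ , τ , σ∈S , τ∈S , σ∉K′ ∘ K⊆K′ , τ∉K′ ∘ K⊆K′ , Fσ≡Fτ ,
                       ElemExpansion-resp-≐ (K′⊆K , K⊆K′) expansion)) ,
      MaximalFrom-resp-≐ W (∪₁-cong ν K≐K′) rest
    MaximalFrom-resp-≐ (reg σ τ ∷ W) K≐K′ rest = MaximalFrom-resp-≐ W (∪₂-cong σ τ K≐K′) rest

module _ {n : ℕ} (S : List (Subset n)) (F : Subset n → ℤ) where

  NoFExpansion : Family n → Set
  NoFExpansion K =
    ¬ ∃ λ σ → ∃ λ τ → σ ∈ₗ S × τ ∈ₗ S × ¬ K σ × ¬ K τ × F σ ≡ F τ × ElemExpansion K σ τ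

  MaximalFSeqFrom : Family n → List (Item n) → Set
  MaximalFSeqFrom K W = FSeqFrom S F K W × MaximalFrom S F K W

  -- FSeqFrom recurses from the front, so a prefix W from K to K′ is described by its continuations.
  LeadsTo : Family n → List (Item n) → Family n → Set
  LeadsTo K W K′ = ∀ W′ → MaximalFSeqFrom K′ W′ → MaximalFSeqFrom K (W ++ W′)

  leadsTo-[] : ∀ {K K′} → K′ ≐ K → LeadsTo K [] K′
  leadsTo-[] K′≐K W′ (seq , max) =
    FSeqFrom-resp-≐ S F W′ K′≐K seq , MaximalFrom-resp-≐ S F W′ K′≐K max

  leadsTo-∷ʳ-crit : ∀ {K K′ K″ W ν} → LeadsTo K W K′ → ElemFilling K′ ν → NoFExpansion K′ →
                    K″ ≐ (K′ ∪₁ ν) → LeadsTo K (W ++ [ crit ν ]) K″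
  leadsTo-∷ʳ-crit {K} {W = W} {ν} leads filling none K″≐ W′ (seq , max) =
    subst (MaximalFSeqFrom K) (sym (LP.++-assoc W [ crit ν ] W′))
      (leads (crit ν ∷ W′) ((filling , FSeqFrom-resp-≐ S F W′ K″≐ seq) ,
                            (none , MaximalFrom-resp-≐ S F W′ K″≐ max)))

  leadsTo-∷ʳ-reg : ∀ {K K′ K″ W σ τ} → LeadsTo K W K′ → ElemExpansion K′ σ τ → F σ ≡ F τ →
                   K″ ≐ (K′ ∪₂ σ , τ) → LeadsTo K (W ++ [ reg σ τ ]) K″
  leadsTo-∷ʳ-reg {K} {W = W} {σ} {τ} leads expansion Fσ≡Fτ K″≐ W′ (seq , max) =
    subst (MaximalFSeqFrom K) (sym (LP.++-assoc W [ reg σ τ ] W′))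
      (leads (reg σ τ ∷ W′) ((expansion , Fσ≡Fτ , FSeqFrom-resp-≐ S F W′ K″≐ seq) ,
                             MaximalFrom-resp-≐ S F W′ K″≐ max))

module Cosimplicial {n : ℕ} {S : List (Subset n)} (cosimplicial : IsCosimplicial S) where

  private
    nonempty = proj₁ cosimplicial
    convex   = proj₂ cosimplicial

  Under-closed : ∀ {μ ν} → Under S μ → Nonempty ν → ν ⊆ μ → Under S ν
  Under-closed ((_ , w , w∈S , μ⊆w) , μ∉S) ν≠∅ ν⊆μ =
    (ν≠∅ , w , w∈S , μ⊆w ∘ ν⊆μ) , λ ν∈S → μ∉S (convex _ _ w ν∈S w∈S ν⊆μ μ⊆w)

  Under-isComplex : IsComplex (Under S)
  Under-isComplex = (λ _ → proj₁ ∘ proj₁) , λ _ _ → Under-closed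

  record IsDownClosed (T : List (Subset n)) : Set where
    field
      T⊆S      : ∀ {μ} → μ ∈ₗ T → μ ∈ₗ S
      downward : ∀ {μ ν} → μ ∈ₗ T → ν ∈ₗ S → ν ⊆ μ → ν ∈ₗ T

  []-isDownClosed : IsDownClosed []
  []-isDownClosed = record { T⊆S = λ () ; downward = λ () }

  insert-isDownClosed : ∀ {T σ} → IsDownClosed T → σ ∈ₗ S → (∀ {ν} → ν ∈ₗ S → ν ⊊ σ → ν ∈ₗ T) →
                        IsDownClosed (insert σ T)
  insert-isDownClosed {T} {σ} T↓ σ∈S faces∈T = record { T⊆S = T⊆S⁺ ; downward = downward⁺ }
    where
    open IsDownClosed T↓
    T⊆S⁺ : ∀ {μ} → μ ∈ₗ insert σ T → μ ∈ₗ S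
    T⊆S⁺ μ∈T⁺ with ∈-insert⁻ {T = T} μ∈T⁺
    ... | inj₁ μ∈T = T⊆S μ∈T
    ... | inj₂ refl = σ∈S
    downward⁺ : ∀ {μ ν} → μ ∈ₗ insert σ T → ν ∈ₗ S → ν ⊆ μ → ν ∈ₗ insert σ T
    downward⁺ {ν = ν} μ∈T⁺ ν∈S ν⊆μ with ∈-insert⁻ {T = T} μ∈T⁺ | ν ≟S σ
    ... | inj₁ μ∈T | _        = ∈-insert⁺ (downward μ∈T ν∈S ν⊆μ)
    ... | inj₂ refl | yes refl = x∈insert {T = T}
    ... | inj₂ refl | no ν≢σ   = ∈-insert⁺ (faces∈T ν∈S (ν⊆μ , ν≢σ))

  K⟨_⟩ : List (Subset n) → Family n
  K⟨ T ⟩ μ = Under S μ ⊎ μ ∈ₗ T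

  K⟨[]⟩ : K⟨ [] ⟩ ≐ Under S
  K⟨[]⟩ = (λ { (inj₁ μ∈S̲) → μ∈S̲ }) , inj₁

  K⟨insert⟩ : ∀ σ T → K⟨ insert σ T ⟩ ≐ (K⟨ T ⟩ ∪₁ σ)
  K⟨insert⟩ σ T = to , from
    where
    to : ∀ {μ} → K⟨ insert σ T ⟩ μ → (K⟨ T ⟩ ∪₁ σ) μ
    to (inj₁ μ∈S̲) = inj₁ (inj₁ μ∈S̲)
    to (inj₂ μ∈T⁺) = Data.Sum.map₁ inj₂ (∈-insert⁻ {T = T} μ∈T⁺)
    from : ∀ {μ} → (K⟨ T ⟩ ∪₁ σ) μ → K⟨ insert σ T ⟩ μ
    from (inj₁ (inj₁ μ∈S̲)) = inj₁ μ∈S̲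
    from (inj₁ (inj₂ μ∈T)) = inj₂ (∈-insert⁺ μ∈T)
    from (inj₂ refl)       = inj₂ (x∈insert {T = T})

  K⟨insert²⟩ : ∀ σ τ T → K⟨ insert τ (insert σ T) ⟩ ≐ (K⟨ T ⟩ ∪₂ σ , τ)
  K⟨insert²⟩ σ τ T = to , from
    where
    to : ∀ {μ} → K⟨ insert τ (insert σ T) ⟩ μ → (K⟨ T ⟩ ∪₂ σ , τ) μ
    to μ∈K with proj₁ (K⟨insert⟩ τ (insert σ T)) μ∈K
    ... | inj₂ μ≡τ = inj₂ (inj₂ μ≡τ)
    ... | inj₁ μ∈K′ with proj₁ (K⟨insert⟩ σ T) μ∈K′
    ...   | inj₁ μ∈K″ = inj₁ μ∈K″
    ...   | inj₂ μ≡σ  = inj₂ (inj₁ μ≡σ)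
    from : ∀ {μ} → (K⟨ T ⟩ ∪₂ σ , τ) μ → K⟨ insert τ (insert σ T) ⟩ μ
    from (inj₁ (inj₁ μ∈S̲))  = inj₁ μ∈S̲
    from (inj₁ (inj₂ μ∈T))  = inj₂ (∈-insert⁺ (∈-insert⁺ μ∈T))
    from (inj₂ (inj₁ refl)) = inj₂ (∈-insert⁺ (x∈insert {T = T}))
    from (inj₂ (inj₂ refl)) = inj₂ (x∈insert {T = insert σ T})

  K⟨⟩-isComplex : ∀ {T} → IsDownClosed T → IsComplex K⟨ T ⟩
  K⟨⟩-isComplex {T} T↓ = K-nonempty , K-closed
    where
    open IsDownClosed T↓
    K-nonempty : ∀ μ → K⟨ T ⟩ μ → Nonempty μ
    K-nonempty _ (inj₁ μ∈S̲) = proj₁ (proj₁ μ∈S̲)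
    K-nonempty μ (inj₂ μ∈T) = nonempty μ (T⊆S μ∈T)
    K-closed : ∀ ν μ → K⟨ T ⟩ μ → Nonempty ν → ν ⊆ μ → K⟨ T ⟩ ν
    K-closed ν μ (inj₁ μ∈S̲) ν≠∅ ν⊆μ = inj₁ (Under-closed μ∈S̲ ν≠∅ ν⊆μ)
    K-closed ν μ (inj₂ μ∈T) ν≠∅ ν⊆μ with ν ∈?ₗ S
    ... | yes ν∈S = inj₂ (downward μ∈T ν∈S ν⊆μ)
    ... | no ν∉S  = inj₁ ((ν≠∅ , μ , T⊆S μ∈T , ν⊆μ) , ν∉S)

  ∉K⟨⟩ : ∀ {T σ} → σ ∈ₗ S → σ ∉ₗ T → ¬ K⟨ T ⟩ σ
  ∉K⟨⟩ σ∈S σ∉T (inj₁ (_ , σ∉S)) = σ∉S σ∈S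
  ∉K⟨⟩ σ∈S σ∉T (inj₂ σ∈T)       = σ∉T σ∈T

  no-coface-in-K⟨⟩ : ∀ {T σ μ} → IsDownClosed T → σ ∈ₗ S → σ ∉ₗ T → K⟨ T ⟩ μ → σ ⊆ μ → ⊥
  no-coface-in-K⟨⟩ T↓ σ∈S σ∉T μ∈K σ⊆μ =
    ∉K⟨⟩ σ∈S σ∉T (proj₂ (K⟨⟩-isComplex T↓) _ _ μ∈K (nonempty _ σ∈S) σ⊆μ)

  filling : ∀ {T σ} → IsDownClosed T → IsDownClosed (insert σ T) → σ ∈ₗ S → σ ∉ₗ T →
            ElemFilling K⟨ T ⟩ σ
  filling {T} {σ} T↓ Tσ↓ σ∈S σ∉T =
    ∉K⟨⟩ σ∈S σ∉T , IsComplex-resp-≐ (K⟨insert⟩ σ T) (K⟨⟩-isComplex Tσ↓) , inj₂ refl , maximal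
    where
    maximal : ∀ μ → (K⟨ T ⟩ ∪₁ σ) μ → σ ⊆ μ → μ ≡ σ
    maximal μ (inj₁ μ∈K) σ⊆μ = ⊥-elim (no-coface-in-K⟨⟩ T↓ σ∈S σ∉T μ∈K σ⊆μ)
    maximal μ (inj₂ μ≡σ) _   = μ≡σ

  expansion : ∀ {T σ τ} → IsDownClosed T → IsDownClosed (insert τ (insert σ T)) →
              σ ∈ₗ S → τ ∈ₗ S → σ ∉ₗ T → σ ⋖ τ → ElemExpansion K⟨ T ⟩ σ τ
  expansion {T} {σ} {τ} T↓ Tστ↓ σ∈S τ∈S σ∉T σ⋖τ =
    ∉K⟨⟩ σ∈S σ∉T , ∉K⟨⟩ τ∈S τ∉T ,
    IsComplex-resp-≐ (K⟨insert²⟩ σ τ T) (K⟨⟩-isComplex Tστ↓) ,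
    inj₂ (inj₁ refl) , inj₂ (inj₂ refl) , ⋖⇒⊊ σ⋖τ , free
    where
    τ∉T : τ ∉ₗ T
    τ∉T τ∈T = σ∉T (IsDownClosed.downward T↓ τ∈T σ∈S (proj₁ σ⋖τ))
    free : ∀ μ → (K⟨ T ⟩ ∪₂ σ , τ) μ → σ ⊆ μ → μ ≡ σ ⊎ μ ≡ τ
    free μ (inj₁ μ∈K) σ⊆μ = ⊥-elim (no-coface-in-K⟨⟩ T↓ σ∈S σ∉T μ∈K σ⊆μ)
    free μ (inj₂ μ≡σ∨τ) _ = μ≡σ∨τ

  K⟨⟩⇔Closure : ∀ {T} → IsDownClosed T → (∀ {μ} → μ ∈ₗ S → μ ∈ₗ T) →
                ∀ μ → K⟨ T ⟩ μ ⇔ Closure S μ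
  K⟨⟩⇔Closure {T} T↓ S⊆T μ = mk⇔ to from
    where
    to : K⟨ T ⟩ μ → Closure S μ
    to (inj₁ μ∈S̲) = proj₁ μ∈S̲
    to (inj₂ μ∈T) = nonempty μ μ∈S , μ , μ∈S , (λ x∈μ → x∈μ)
      where μ∈S = IsDownClosed.T⊆S T↓ μ∈T
    from : Closure S μ → K⟨ T ⟩ μ
    from μ∈S̄ with μ ∈?ₗ S
    ... | yes μ∈S = inj₂ (S⊆T μ∈S)
    ... | no μ∉S  = inj₁ (μ∈S̄ , μ∉S)

proper-faces-precede : ∀ {n} {S : List (Subset n)} {F : Subset n → ℤ} →
                       IsStack S F → IsAdmissibleEnumeration S F →
                       ∀ {j k} → lookup S k ⊊ lookup S j → toℕ k < toℕ j
proper-faces-precede {S = S} stack admissible {j} {k} Sₖ⊊Sⱼ with ℕP.<-cmp (toℕ k) (toℕ j)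
... | tri< k<j _ _ = k<j
... | tri≈ _ k≡j _ = contradiction (cong (lookup S) (FinP.toℕ-injective k≡j)) (proj₂ Sₖ⊊Sⱼ)
... | tri> _ _ j<k = contradiction ∣Sⱼ∣≤∣Sₖ∣ (ℕP.<⇒≱ (p⊂q⇒∣p∣<∣q∣ (⊊⇒⊂ Sₖ⊊Sⱼ)))
  where
  Fⱼ≡Fₖ = ℤP.≤-antisym (proj₁ (admissible j k j<k))
                        (stack _ _ (∈-lookup k) (∈-lookup j) (proj₁ Sₖ⊊Sⱼ))
  ∣Sⱼ∣≤∣Sₖ∣ = dim-mono⁻¹ (lookup S j) (lookup S k) (proj₂ (admissible j k j<k) Fⱼ≡Fₖ)

module Max {n : ℕ} (S : List (Subset n)) (F : Subset n → ℤ)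
           (cosimplicial : IsCosimplicial S) (S! : Unique S)
           (stack : IsStack S F) (admissible : IsAdmissibleEnumeration S F) where

  open Cosimplicial cosimplicial

  ∂L-unique : ∀ τ → Unique (∂L S τ)
  ∂L-unique τ = Unique.filter⁺ (λ μ → (μ ⊆? τ) ×-dec (dim μ ℤ.≟ dim τ ℤ.- + 1)) S!

  δL-unique : ∀ σ → Unique (δL S σ)
  δL-unique σ = Unique.filter⁺ (λ μ → (σ ⊆? μ) ×-dec (dim μ ℤ.≟ dim σ ℤ.+ + 1)) S!

  -- Facets of μ outside S lie in S̲ from the start, so ρ μ only counts those in S outside T.
  Counts : List (Subset n) → (Subset n → ℤ) → Set
  Counts T ρ = ∀ {μ} → μ ∈ₗ S → ρ μ ≡ + length (∂L S μ ∖ T)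

  Eligible : List (Subset n) → (Subset n → ℤ) → Subset n → Set
  Eligible T ρ μ = μ ∈ₗ S × μ ∉ₗ T × ρ μ ≡ + 1 × ∃ λ φ → φ ∈ₗ ∂L S μ × φ ∉ₗ T × F φ ≡ F μ

  record Bookkeeping (T U : List (Subset n)) (ρ : Subset n → ℤ) : Set where
    field
      counts   : Counts T ρ
      U⊆S      : ∀ {μ} → μ ∈ₗ U → μ ∈ₗ S
      complete : ∀ {μ} → Eligible T ρ μ → μ ∈ₗ U

  free-face-unique : ∀ {T ρ τ φ ψ} → Counts T ρ → τ ∈ₗ S → ρ τ ≡ + 1 →
                     φ ∈ₗ ∂L S τ → φ ∉ₗ T → ψ ∈ₗ ∂L S τ → ψ ∉ₗ T → φ ≡ ψ
  free-face-unique {T} counts τ∈S ρτ≡1 φ∈∂τ φ∉T ψ∈∂τ ψ∉T =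
    length≡1⇒≡ (ℤP.+-injective (trans (sym (counts τ∈S)) ρτ≡1))
      (∈-filter⁺ (λ y → ¬? (y ∈?ₗ T)) φ∈∂τ φ∉T) (∈-filter⁺ (λ y → ¬? (y ∈?ₗ T)) ψ∈∂τ ψ∉T)

  count-insert-∈ : ∀ T {x μ} → x ∈ₗ S → x ∉ₗ T → μ ∈ₗ δL S x →
                   suc (length (∂L S μ ∖ insert x T)) ≡ length (∂L S μ ∖ T)
  count-insert-∈ T {μ = μ} x∈S x∉T μ∈δx =
    length-∖-insert-∈ T (∂L S μ) (∂L-unique μ) (∈-∂L⁺ S x∈S (proj₂ (∈-δL⁻ S μ∈δx))) x∉T

  count-insert-∉ : ∀ T {x μ} → μ ∈ₗ S → μ ∉ₗ δL S x →
                   length (∂L S μ ∖ insert x T) ≡ length (∂L S μ ∖ T)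
  count-insert-∉ T {μ = μ} μ∈S μ∉δx =
    cong length (∖-insert-∉ T (∂L S μ) (λ x∈∂μ → μ∉δx (∈-δL⁺ S μ∈S (proj₂ (∈-∂L⁻ S x∈∂μ)))))

  Eligible-antitone : ∀ {T T′ ρ μ} → (∀ {ν} → ν ∈ₗ T → ν ∈ₗ T′) →
                      Eligible T′ ρ μ → Eligible T ρ μ
  Eligible-antitone T⊆T′ (μ∈S , μ∉T′ , ρμ≡1 , φ , φ∈∂μ , φ∉T′ , Fφ≡Fμ) =
    μ∈S , μ∉T′ ∘ T⊆T′ , ρμ≡1 , φ , φ∈∂μ , φ∉T′ ∘ T⊆T′ , Fφ≡Fμ

  Bookkeeping-remove : ∀ {T U ρ τ} → Bookkeeping T U ρ → ¬ Eligible T ρ τ →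
                       Bookkeeping T (remove τ U) ρ
  Bookkeeping-remove {U = U} book τ-ineligible = record
    { counts   = counts
    ; U⊆S      = U⊆S ∘ ∈-remove⁻ {U = U}
    ; complete = λ μ-eligible →
        ∈-remove⁺ (complete μ-eligible) λ { refl → τ-ineligible μ-eligible }
    }
    where open Bookkeeping book

  F-differs⇒¬Eligible : ∀ {T ρ τ σ} → Counts T ρ → ρ τ ≡ + 1 → σ ∈ₗ ∂L S τ → σ ∉ₗ T →
                        F τ ≢ F σ → ¬ Eligible T ρ τ
  F-differs⇒¬Eligible counts ρτ≡1 σ∈∂τ σ∉T Fτ≢Fσ (τ∈S , _ , _ , φ , φ∈∂τ , φ∉T , Fφ≡Fτ) =
    Fτ≢Fσ (trans (sym Fφ≡Fτ) (cong F (free-face-unique counts τ∈S ρτ≡1 φ∈∂τ φ∉T σ∈∂τ σ∉T)))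

  recount : ∀ {T T′ U₀ ρ L} → Counts T ρ → Unique L → (∀ {μ} → μ ∈ₗ L → μ ∈ₗ S) →
            (∀ {μ} → μ ∈ₗ S → μ ∈ₗ L → suc (length (∂L S μ ∖ T′)) ≡ length (∂L S μ ∖ T)) →
            (∀ {μ} → μ ∈ₗ S → μ ∉ₗ L → length (∂L S μ ∖ T′) ≡ length (∂L S μ ∖ T)) →
            (∀ {μ} → μ ∈ₗ U₀ → μ ∈ₗ S) → (∀ {μ} → μ ∉ₗ L → Eligible T′ ρ μ → μ ∈ₗ U₀) →
            Bookkeeping T′ (proj₂ (decrAll L ρ U₀)) (proj₁ (decrAll L ρ U₀))
  recount {T} {T′} {U₀} {ρ} {L} counts L! L⊆S drop keep U₀⊆S old = record
    { counts = counts′ ; U⊆S = U⊆S′ ; complete = complete′ }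
    where
    counts′ : Counts T′ (proj₁ (decrAll L ρ U₀))
    counts′ {μ} μ∈S with μ ∈?ₗ L
    ... | yes μ∈L = begin
      proj₁ (decrAll L ρ U₀) μ             ≡⟨ decrAll-ρ-∈ L ρ U₀ L! μ∈L ⟩
      ρ μ ℤ.- + 1                          ≡⟨ cong (ℤ._- + 1) (counts μ∈S) ⟩
      + length (∂L S μ ∖ T) ℤ.- + 1        ≡⟨ cong (λ k → + k ℤ.- + 1) (drop μ∈S μ∈L) ⟨
      + length (∂L S μ ∖ T′)               ∎
    ... | no μ∉L = begin
      proj₁ (decrAll L ρ U₀) μ             ≡⟨ decrAll-ρ-∉ L ρ U₀ μ∉L ⟩
      ρ μ                                  ≡⟨ counts μ∈S ⟩
      + length (∂L S μ ∖ T)                ≡⟨ cong +_ (keep μ∈S μ∉L) ⟨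
      + length (∂L S μ ∖ T′)               ∎
    U⊆S′ : ∀ {μ} → μ ∈ₗ proj₂ (decrAll L ρ U₀) → μ ∈ₗ S
    U⊆S′ μ∈U with decrAll-U⁻ L ρ U₀ μ∈U
    ... | inj₁ μ∈U₀ = U₀⊆S μ∈U₀
    ... | inj₂ μ∈L  = L⊆S μ∈L
    complete′ : ∀ {μ} → Eligible T′ (proj₁ (decrAll L ρ U₀)) μ → μ ∈ₗ proj₂ (decrAll L ρ U₀)
    complete′ {μ} (μ∈S , μ∉T′ , ρ′μ≡1 , face) with μ ∈?ₗ L
    ... | yes μ∈L = decrAll-U-new L ρ U₀ L! μ∈L ρ′μ≡1
    ... | no μ∉L  = decrAll-U⁺ L ρ U₀ (old μ∉L (μ∈S , μ∉T′ , ρμ≡1 , face))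
      where ρμ≡1 = trans (sym (decrAll-ρ-∉ L ρ U₀ μ∉L)) ρ′μ≡1

  recount-insert : ∀ {T U₀ ρ σ} → Counts T ρ → σ ∈ₗ S → σ ∉ₗ T → (∀ {μ} → μ ∈ₗ U₀ → μ ∈ₗ S) →
                   (∀ {μ} → μ ∉ₗ δL S σ → Eligible (insert σ T) ρ μ → μ ∈ₗ U₀) →
                   let r = decrAll (δL S σ) ρ U₀ in Bookkeeping (insert σ T) (proj₂ r) (proj₁ r)
  recount-insert {T} {σ = σ} counts σ∈S σ∉T =
    recount counts (δL-unique σ) (proj₁ ∘ ∈-δL⁻ S)
      (λ _ → count-insert-∈ T σ∈S σ∉T) (count-insert-∉ T)

  recount-insert² : ∀ {T U₀ ρ σ τ} → Counts T ρ → σ ∈ₗ S → τ ∈ₗ S → σ ⋖ τ → σ ∉ₗ T →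
                    τ ∉ₗ insert σ T → (∀ {μ} → μ ∈ₗ U₀ → μ ∈ₗ S) →
                    let L = deduplicate _≟S_ (δL S σ ++ δL S τ) ; r = decrAll L ρ U₀ in
                    (∀ {μ} → μ ∉ₗ L → Eligible (insert τ (insert σ T)) ρ μ → μ ∈ₗ U₀) →
                    Bookkeeping (insert τ (insert σ T)) (proj₂ r) (proj₁ r)
  recount-insert² {T} {σ = σ} {τ} counts σ∈S τ∈S σ⋖τ σ∉T τ∉Tσ =
    recount counts (deduplicate-! _≟S_ (δL S σ ++ δL S τ)) L⊆S drop keep
    where
    ∈-L⁻ : ∀ {μ} → μ ∈ₗ deduplicate _≟S_ (δL S σ ++ δL S τ) → μ ∈ₗ δL S σ ⊎ μ ∈ₗ δL S τ
    ∈-L⁻ = ∈-++⁻ (δL S σ) ∘ ∈-deduplicate⁻ _≟S_ (δL S σ ++ δL S τ)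

    L⊆S : ∀ {μ} → μ ∈ₗ deduplicate _≟S_ (δL S σ ++ δL S τ) → μ ∈ₗ S
    L⊆S = Data.Sum.[ proj₁ ∘ ∈-δL⁻ S , proj₁ ∘ ∈-δL⁻ S ] ∘ ∈-L⁻

    -- No simplex is a coface of both σ and τ, since their sizes differ by one.
    drop : ∀ {μ} → μ ∈ₗ S → μ ∈ₗ deduplicate _≟S_ (δL S σ ++ δL S τ) →
           suc (length (∂L S μ ∖ insert τ (insert σ T))) ≡ length (∂L S μ ∖ T)
    drop {μ} μ∈S μ∈L with ∈-L⁻ μ∈L
    ... | inj₁ μ∈δσ = begin
      suc (length (∂L S μ ∖ insert τ (insert σ T)))
        ≡⟨ cong suc (count-insert-∉ (insert σ T) μ∈S μ∉δτ) ⟩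
      suc (length (∂L S μ ∖ insert σ T))
        ≡⟨ count-insert-∈ T σ∈S σ∉T μ∈δσ ⟩
      length (∂L S μ ∖ T)
        ∎
      where
      μ∉δτ : μ ∉ₗ δL S τ
      μ∉δτ μ∈δτ = no-⋖-triangle σ⋖τ (proj₂ (∈-δL⁻ S μ∈δτ)) (proj₂ (∈-δL⁻ S μ∈δσ))
    ... | inj₂ μ∈δτ = begin
      suc (length (∂L S μ ∖ insert τ (insert σ T)))
        ≡⟨ count-insert-∈ (insert σ T) τ∈S τ∉Tσ μ∈δτ ⟩
      length (∂L S μ ∖ insert σ T)
        ≡⟨ count-insert-∉ T μ∈S μ∉δσ ⟩
      length (∂L S μ ∖ T)
        ∎
      where
      μ∉δσ : μ ∉ₗ δL S σ
      μ∉δσ μ∈δσ = no-⋖-triangle σ⋖τ (proj₂ (∈-δL⁻ S μ∈δτ)) (proj₂ (∈-δL⁻ S μ∈δσ))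

    keep : ∀ {μ} → μ ∈ₗ S → μ ∉ₗ deduplicate _≟S_ (δL S σ ++ δL S τ) →
           length (∂L S μ ∖ insert τ (insert σ T)) ≡ length (∂L S μ ∖ T)
    keep μ∈S μ∉L =
      trans (count-insert-∉ (insert σ T) μ∈S (μ∉L ∘ ∈-deduplicate⁺ _≟S_ ∘ ∈-++⁺ʳ (δL S σ)))
            (count-insert-∉ T μ∈S (μ∉L ∘ ∈-deduplicate⁺ _≟S_ ∘ ∈-++⁺ˡ))

  -- A proper face ν ≠ σ of τ lies in a facet φ ≠ σ, which is in T since σ is the only free facet.
  other-faces-in-T : ∀ {T ρ τ σ ν} → IsDownClosed T → Counts T ρ → τ ∈ₗ S → ρ τ ≡ + 1 →
                     σ ∈ₗ ∂L S τ → σ ∉ₗ T → ν ∈ₗ S → ν ⊊ τ → ν ≢ σ → ν ∈ₗ T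
  other-faces-in-T {T} {τ = τ} {ν = ν} T↓ counts τ∈S ρτ≡1 σ∈∂τ σ∉T ν∈S ν⊊τ ν≢σ
    with facet-avoiding ν⊊τ ν≢σ
  ... | φ , ν⊆φ , φ⋖τ , φ≢σ with φ ∈?ₗ T
  ...   | yes φ∈T = IsDownClosed.downward T↓ φ∈T ν∈S ν⊆φ
  ...   | no φ∉T  =
    ⊥-elim (φ≢σ (free-face-unique counts τ∈S ρτ≡1 (∈-∂L⁺ S φ∈S φ⋖τ) φ∉T σ∈∂τ σ∉T))
    where φ∈S = proj₂ cosimplicial ν φ τ ν∈S τ∈S ν⊆φ (proj₁ φ⋖τ)

  expansion⇒Eligible : ∀ {T ρ σ τ} → Counts T ρ → σ ∈ₗ S → τ ∈ₗ S → ¬ K⟨ T ⟩ σ → ¬ K⟨ T ⟩ τ →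
                       F σ ≡ F τ → ElemExpansion K⟨ T ⟩ σ τ → Eligible T ρ τ
  expansion⇒Eligible {T} {ρ} {σ} {τ} counts σ∈S τ∈S σ∉K τ∉K Fσ≡Fτ (_ , _ , complex , free) =
    τ∈S , τ∉K ∘ inj₂ , trans (counts τ∈S) (cong +_ one-free-face) , σ , σ∈∂τ , σ∉K ∘ inj₂ , Fσ≡Fτ
    where
    σ∈∂τ : σ ∈ₗ ∂L S τ
    σ∈∂τ = ∈-∂L⁺ S σ∈S (FreePair⇒⋖ complex free)
    only-σ : ∀ {φ} → φ ∈ₗ ∂L S τ ∖ T → φ ≡ σ
    only-σ {φ} φ∈∂τ∖T with ∈-filter⁻ (λ y → ¬? (y ∈?ₗ T)) φ∈∂τ∖T
    ... | φ∈∂τ , φ∉T with ∈-∂L⁻ S φ∈∂τ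
    ... | φ∈S , φ⋖τ with proj₂ complex φ τ (inj₂ (inj₂ refl)) (proj₁ cosimplicial φ φ∈S) (proj₁ φ⋖τ)
    ...   | inj₁ φ∈K         = ⊥-elim (∉K⟨⟩ φ∈S φ∉T φ∈K)
    ...   | inj₂ (inj₁ φ≡σ)  = φ≡σ
    ...   | inj₂ (inj₂ refl) = ⊥-elim (proj₂ (⋖⇒⊊ φ⋖τ) refl)
    one-free-face : length (∂L S τ ∖ T) ≡ 1
    one-free-face = unique-singleton (Unique.filter⁺ (λ y → ¬? (y ∈?ₗ T)) (∂L-unique τ))
                      (∈-filter⁺ (λ y → ¬? (y ∈?ₗ T)) σ∈∂τ (σ∉K ∘ inj₂)) only-σ

  record Invariant (i : ℕ) (T U : List (Subset n)) (ρ : Subset n → ℤ) (W : List (Item n)) :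
                   Set where
    field
      T↓      : IsDownClosed T
      book    : Bookkeeping T U ρ
      scanned : ∀ k → suc (toℕ k) < i → lookup S k ∈ₗ T
      leads   : LeadsTo S F (Under S) W K⟨ T ⟩
    open IsDownClosed T↓ public
    open Bookkeeping book public

  initial : Invariant 1 [] (filter (λ τ → ρ₀ S F τ ℤ.≟ + 1) S) (ρ₀ S F) []
  initial = record
    { T↓      = []-isDownClosed
    ; book    = record
      { counts   = λ {μ} _ → cong (λ xs → + length xs) (sym (xs∖[]≡xs (∂L S μ)))
      ; U⊆S      = proj₁ ∘ ∈-filter⁻ (λ τ → ρ₀ S F τ ℤ.≟ + 1)
      ; complete = λ (μ∈S , _ , ρ₀μ≡1 , _) → ∈-filter⁺ (λ τ → ρ₀ S F τ ℤ.≟ + 1) μ∈S ρ₀μ≡1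
      }
    ; scanned = λ { _ (s≤s ()) }
    ; leads   = leadsTo-[] S F K⟨[]⟩
    }

  discard : ∀ {i T U ρ W τ} → Invariant i T U ρ W → ¬ Eligible T ρ τ →
            Invariant i T (remove τ U) ρ W
  discard I τ-ineligible = record
    { T↓ = T↓ ; book = Bookkeeping-remove book τ-ineligible ; scanned = scanned ; leads = leads }
    where open Invariant I

  advance : ∀ {i T U ρ W σ} → Invariant i T U ρ W → entry S i ≡ just σ → σ ∈ₗ T →
            Invariant (suc i) T U ρ W
  advance {i} {T} {σ = σ} I Sᵢ≡σ σ∈T =
    record { T↓ = T↓ ; book = book ; scanned = scanned′ ; leads = leads }
    where
    open Invariant I
    scanned′ : ∀ k → suc (toℕ k) < suc i → lookup S k ∈ₗ T
    scanned′ k k<i+1 with ℕP.m<1+n⇒m<n∨m≡n k<i+1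
    ... | inj₁ k<i  = scanned k k<i
    ... | inj₂ refl = subst (_∈ₗ T) (just-injective (trans (sym Sᵢ≡σ) (lookup⇒entry S k))) σ∈T

  faces-scanned : ∀ {i T U ρ W σ ν} → Invariant i T U ρ W → entry S i ≡ just σ →
                  ν ∈ₗ S → ν ⊊ σ → ν ∈ₗ T
  faces-scanned {i} {T} I Sᵢ≡σ ν∈S ν⊊σ with entry⇒lookup S i Sᵢ≡σ
  ... | j , refl , refl = subst (_∈ₗ T) (sym ν≡Sₖ) (Invariant.scanned I k (s≤s k<j))
    where
    k = index ν∈S
    ν≡Sₖ = lookup-index ν∈S
    k<j = proper-faces-precede stack admissible (subst (_⊊ lookup S j) ν≡Sₖ ν⊊σ)

  fill : ∀ {i T ρ W σ} → Invariant i T [] ρ W → entry S i ≡ just σ → σ ∉ₗ T →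
         let r = decrAll (δL S σ) ρ []
         in Invariant i (insert σ T) (proj₂ r) (proj₁ r) (W ++ [ crit σ ])
  fill {i} {T} {ρ} {W} {σ} I Sᵢ≡σ σ∉T = record
    { T↓      = Tσ↓
    ; book    = recount-insert counts σ∈S σ∉T (λ ())
                  (λ _ → complete ∘ Eligible-antitone {ρ = ρ} ∈-insert⁺)
    ; scanned = λ k k<i → ∈-insert⁺ (scanned k k<i)
    ; leads   = leadsTo-∷ʳ-crit S F leads (filling T↓ Tσ↓ σ∈S σ∉T) no-F-expansion
                  (K⟨insert⟩ σ T)
    }
    where
    open Invariant I
    σ∈S : σ ∈ₗ S
    σ∈S = entry-∈ S i Sᵢ≡σ
    Tσ↓ : IsDownClosed (insert σ T)
    Tσ↓ = insert-isDownClosed T↓ σ∈S (faces-scanned I Sᵢ≡σ)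
    no-F-expansion : NoFExpansion S F K⟨ T ⟩
    no-F-expansion (σ′ , τ′ , σ′∈S , τ′∈S , σ′∉K , τ′∉K , Fσ′≡Fτ′ , σ′τ′-expansion)
      with complete (expansion⇒Eligible counts σ′∈S τ′∈S σ′∉K τ′∉K Fσ′≡Fτ′ σ′τ′-expansion)
    ... | ()

  expand : ∀ {i T U ρ W τ σ} → Invariant i T U ρ W → τ ∈ₗ U → ρ τ ≡ + 1 →
           σ ∈ₗ ∂L S τ → σ ∉ₗ T → F τ ≡ F σ →
           let r = decrAll (deduplicate _≟S_ (δL S σ ++ δL S τ)) ρ (remove τ U)
           in Invariant i (insert τ (insert σ T)) (proj₂ r) (proj₁ r) (W ++ [ reg σ τ ])
  expand {i} {T} {U} {ρ} {W} {τ} {σ} I τ∈U ρτ≡1 σ∈∂τ σ∉T Fτ≡Fσ = record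
    { T↓      = Tστ↓
    ; book    = recount-insert² counts σ∈S τ∈S σ⋖τ σ∉T τ∉Tσ (U⊆S ∘ ∈-remove⁻ {U = U}) old
    ; scanned = λ k k<i → ∈-insert⁺ (∈-insert⁺ (scanned k k<i))
    ; leads   = leadsTo-∷ʳ-reg S F leads (expansion T↓ Tστ↓ σ∈S τ∈S σ∉T σ⋖τ) (sym Fτ≡Fσ)
                  (K⟨insert²⟩ σ τ T)
    }
    where
    open Invariant I
    τ∈S = U⊆S τ∈U
    σ∈S = proj₁ (∈-∂L⁻ S σ∈∂τ)
    σ⋖τ = proj₂ (∈-∂L⁻ S σ∈∂τ)
    other-faces : ∀ {ν} → ν ∈ₗ S → ν ⊊ τ → ν ≢ σ → ν ∈ₗ T
    other-faces = other-faces-in-T T↓ counts τ∈S ρτ≡1 σ∈∂τ σ∉T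

    Tσ↓ : IsDownClosed (insert σ T)
    Tσ↓ = insert-isDownClosed T↓ σ∈S λ ν∈S ν⊊σ →
            other-faces ν∈S (⊆-⊊-trans (proj₁ ν⊊σ) (⋖⇒⊊ σ⋖τ)) (proj₂ ν⊊σ)

    Tστ↓ : IsDownClosed (insert τ (insert σ T))
    Tστ↓ = insert-isDownClosed Tσ↓ τ∈S faces
      where
      faces : ∀ {ν} → ν ∈ₗ S → ν ⊊ τ → ν ∈ₗ insert σ T
      faces {ν} ν∈S ν⊊τ with ν ≟S σ
      ... | yes refl = x∈insert {T = T}
      ... | no ν≢σ   = ∈-insert⁺ (other-faces ν∈S ν⊊τ ν≢σ)

    τ∉Tσ : τ ∉ₗ insert σ T
    τ∉Tσ = ∉-insert (λ τ∈T → σ∉T (downward τ∈T σ∈S (proj₁ σ⋖τ))) (proj₂ (⋖⇒⊊ σ⋖τ) ∘ sym)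

    old : ∀ {μ} → μ ∉ₗ deduplicate _≟S_ (δL S σ ++ δL S τ) →
          Eligible (insert τ (insert σ T)) ρ μ → μ ∈ₗ remove τ U
    old _ μ-eligible@(_ , μ∉Tστ , _) =
      ∈-remove⁺ (complete (Eligible-antitone {ρ = ρ} (∈-insert⁺ ∘ ∈-insert⁺) μ-eligible))
                λ { refl → μ∉Tστ (x∈insert {T = insert σ T}) }

  PhaseInvariant : State n → Set
  PhaseInvariant (st loop _ _ _ _ _) = ⊤
  PhaseInvariant (st pa _ _ _ _ _)   = ⊤
  PhaseInvariant (st pb _ _ U _ _)   = U ≡ []
  PhaseInvariant (st pc i T U _ _)   =
    U ≡ [] × ¬ (∃ λ σ → i ≤ length S × entry S i ≡ just σ × σ ∈ₗ T)
  PhaseInvariant (st done i _ _ _ _) = ¬ i ≤ length S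

  StateInvariant : State n → Set
  StateInvariant s@(st _ i T U ρ W) = Invariant i T U ρ W × PhaseInvariant s

  step-preserves : ∀ {s s′} → StateInvariant s → Step S F s s′ → StateInvariant s′
  step-preserves (I , _) (loop-go _)       = I , _
  step-preserves (I , _) (loop-stop i>N)   = I , i>N
  step-preserves (I , _) a-exit            = I , refl
  step-preserves (I , _) (a-skip _ ρτ≢1)   = discard I (λ (_ , _ , ρτ≡1 , _) → ρτ≢1 ρτ≡1) , _
  step-preserves (I , _) (a-noexp _ ρτ≡1 σ∈∂τ σ∉T Fτ≢Fσ) =
    discard I (F-differs⇒¬Eligible (Invariant.counts I) ρτ≡1 σ∈∂τ σ∉T Fτ≢Fσ) , _
  step-preserves (I , _) (a-exp τ∈U ρτ≡1 σ∈∂τ σ∉T Fτ≡Fσ) =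
    expand I τ∈U ρτ≡1 σ∈∂τ σ∉T Fτ≡Fσ , _
  step-preserves (I , U≡[]) (b-next _ Sᵢ≡σ σ∈T) = advance I Sᵢ≡σ σ∈T , U≡[]
  step-preserves (I , U≡[]) (b-exit Sᵢ∉T)       = I , U≡[] , Sᵢ∉T
  step-preserves (I , refl , Sᵢ∉T) (c-crit i≤N Sᵢ≡σ) =
    fill I Sᵢ≡σ (λ σ∈T → Sᵢ∉T (_ , i≤N , Sᵢ≡σ , σ∈T)) , _
  step-preserves (I , _) (c-skip _)        = I , _

  reachable-invariant : ∀ {s} → Star (Step S F) (initState S F) s → StateInvariant s
  reachable-invariant = go (initial , _)
    where
    go : ∀ {s s′} → StateInvariant s → Star (Step S F) s s′ → StateInvariant s′
    go R ε          = R
    go R (step ◅ run) = go (step-preserves R step) run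

  all-scanned : ∀ {i T U ρ W μ} → Invariant i T U ρ W → ¬ i ≤ length S → μ ∈ₗ S → μ ∈ₗ T
  all-scanned {T = T} I i>N μ∈S = subst (_∈ₗ T) (sym (lookup-index μ∈S)) (Invariant.scanned I k k<i)
    where
    k = index μ∈S
    k<i = ℕP.<-≤-trans (s≤s (FinP.toℕ<n k)) (ℕP.≰⇒> i>N)

  terminal-sound : ∀ {i T U ρ W} → StateInvariant (st done i T U ρ W) → IsMaximalFSequence S F W
  terminal-sound {W = W} (I , i>N) =
    (Under-isComplex , subst (FSeqFrom S F (Under S)) (LP.++-identityʳ W) (proj₁ W-maximal)) ,
    subst (MaximalFrom S F (Under S)) (LP.++-identityʳ W) (proj₂ W-maximal)
    where
    open Invariant I
    W-maximal = leads [] (K⟨⟩⇔Closure T↓ (all-scanned I i>N) , _)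

proposition6 : ∀ {n : ℕ} (S : List (Subset n)) (F : Subset n → ℤ) →
    IsCosimplicial S → Unique S → IsStack S F → IsAdmissibleEnumeration S F →
    ∀ (W : List (Item n)) → IsMaxOutput S F W → IsMaximalFSequence S F W
proposition6 S F cosimplicial S! stack admissible W (st _ _ _ _ _ _ , run , refl , refl) =
  terminal-sound (reachable-invariant run)
  where open Max S F cosimplicial S! stack admissible
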